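{- Any two elements of the monoid $\langle\mathbf A\mid\mathbf R\rangle^+$ admit a common right-multiple: for all $f,g$ there exist $f',g'$ with $fg'=gf'$.
   Context: Let $\mathbf A=\{a_\alpha\}$ be an alphabet indexed by all addresses $\alpha$ (finite words over $\{0,1\}$). Addresses $\alpha,\beta$ are orthogonal ($\alpha\perp\beta$) if there is an address $\gamma$ such that $\alpha$ begins with $\gamma0$ and $\beta$ with $\gamma1$, or vice versa. $\mathbf R$ is the family of relations, for all addresses $\alpha,\beta$: $a_\alpha a_\beta=a_\beta a_\alpha$ for $\alpha\perp\beta$; $a_{\alpha11\beta}a_\alpha=a_\alpha a_{\alpha1\beta}$; $a_{\alpha10\beta}a_\alpha=a_\alpha a_{\alpha01\beta}$; $a_{\alpha0\beta}a_\alpha=a_\alpha a_{\alpha00\beta}$; $a_\alpha^2=a_{\alpha1}a_\alpha a_{\alpha0}$. $\langle\mathbf A\mid\mathbf R\rangle^+$ is the monoid presented by generators $\mathbf A$ and relations $\mathbf R$. -}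

module Defs where

open import Data.Bool using (Bool; true; false)
open import Data.List using (List; []; _∷_; _++_; [_])
open import Data.Product using (Σ; ∃; _×_; _,_)
open import Data.Sum using (_⊎_)
open import Relation.Binary.PropositionalEquality using (_≡_)

-- An address is a finite word over {0,1}; 0 = false, 1 = true.
Address : Set
Address = List Bool

BeginsWith : Address → Address → Set
BeginsWith α β = ∃ λ δ → α ≡ β ++ δ

_⊥A_ : Address → Address → Set
α ⊥A β = ∃ λ γ →
  (BeginsWith α (γ ++ [ false ]) × BeginsWith β (γ ++ [ true ]))
  ⊎ (BeginsWith α (γ ++ [ true ]) × BeginsWith β (γ ++ [ false ]))

-- Words over the alphabet A = {a_α}: the letter a_α is represented by α.
Word : Set
Word = List Address

data Rel : Word → Word → Set where
  comm  : ∀ α β → α ⊥A β → Rel (α ∷ β ∷ []) (β ∷ α ∷ [])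
  r11   : ∀ α β → Rel ((α ++ true ∷ true ∷ β) ∷ α ∷ [])
                      (α ∷ (α ++ true ∷ β) ∷ [])
  r10   : ∀ α β → Rel ((α ++ true ∷ false ∷ β) ∷ α ∷ [])
                      (α ∷ (α ++ false ∷ true ∷ β) ∷ [])
  r0    : ∀ α β → Rel ((α ++ false ∷ β) ∷ α ∷ [])
                      (α ∷ (α ++ false ∷ false ∷ β) ∷ [])
  rsq   : ∀ α → Rel (α ∷ α ∷ [])
                    ((α ++ [ true ]) ∷ α ∷ (α ++ [ false ]) ∷ [])

-- The congruence on A* generated by R; the monoid <A | R>^+ is
-- A* modulo this congruence (words, concatenation, empty word).
data _≈_ : Word → Word → Set where
  step  : ∀ u v l r → Rel l r → (u ++ l ++ v) ≈ (u ++ r ++ v)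
  refl≈ : ∀ w → w ≈ w
  sym≈  : ∀ {w w'} → w ≈ w' → w' ≈ w
  trans≈ : ∀ {w w' w''} → w ≈ w' → w' ≈ w'' → w ≈ w''

-- The proof interprets the generator a_α as the rotation at address α,
-- a partial operation on binary trees: a word w "runs" from a tree T to a
-- tree S when its letters can be applied one after the other.  The
-- relations R are exactly what makes the following two facts true.
--
--  * Local confluence: two rotations applicable to the same tree can be
--    completed by words u, v to a common tree, with a_α u ≈ a_β v.
--  * Termination: every rotation strictly decreases a measure μ, so from
--    any tree a "normal run" (a run ending in a tree admitting no rotation)
--    exists.
--
-- A Newman-style well-founded induction turns these into uniqueness:
-- any two normal runs from the same tree spell ≈-equivalent words.
-- Finally every word runs on some tree, runs persist on larger trees, and
-- two trees have a common upper bound.  So f and g both run on some tree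
-- T, to S₁ and S₂; extending by normal runs z₁ from S₁ and z₂ from S₂
-- gives two normal runs f z₁ and g z₂ from T, whence f z₁ ≈ g z₂.
module Submission where

open import Defs
open import Data.List using (_++_)
open import Data.Product using (∃₂)

open import Data.Bool using (Bool; true; false)
open import Data.List using (List; []; _∷_; [_]; map)
open import Data.List.Properties using (++-assoc; ++-identityʳ; map-++)
open import Data.Product using (∃; _×_; _,_)
open import Data.Sum using (_⊎_; inj₁; inj₂)
open import Data.Empty using (⊥-elim)
open import Data.Nat using (ℕ; suc; _+_; _<_; s≤s)
open import Data.Nat.Properties using (+-monoˡ-<; +-monoʳ-<; m≤m+n)
open import Data.Nat.Induction using (<-wellFounded)
open import Data.Nat.Tactic.RingSolver using (solve-∀)
open import Induction.WellFounded using (WellFounded; Acc; acc)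
import Relation.Binary.Construct.On as On
open import Relation.Binary.Bundles using (Setoid)
open import Relation.Nullary using (¬_)
open import Relation.Binary.PropositionalEquality using (_≡_; refl; sym; cong; subst; subst₂)

≈-setoid : Setoid _ _
≈-setoid = record
  { Carrier = Word
  ; _≈_ = _≈_
  ; isEquivalence = record { refl = refl≈ _ ; sym = sym≈ ; trans = trans≈ }
  }

open import Relation.Binary.Reasoning.Setoid ≈-setoid using (begin_; step-≈-⟩; _∎)

prefix : ∀ p {w w'} → w ≈ w' → (p ++ w) ≈ (p ++ w')
prefix p (step u v l r x) =
  subst₂ _≈_ (++-assoc p u (l ++ v)) (++-assoc p u (r ++ v)) (step (p ++ u) v l r x)
prefix p (refl≈ w)     = refl≈ _
prefix p (sym≈ e)      = sym≈ (prefix p e)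
prefix p (trans≈ e e') = trans≈ (prefix p e) (prefix p e')

suffix : ∀ s {w w'} → w ≈ w' → (w ++ s) ≈ (w' ++ s)
suffix s (step u v l r x) = subst₂ _≈_ (reassoc l) (reassoc r) (step u (v ++ s) l r x)
  where
  reassoc : ∀ l → u ++ l ++ v ++ s ≡ (u ++ l ++ v) ++ s
  reassoc l rewrite ++-assoc u (l ++ v) s | ++-assoc l v s = refl
suffix s (refl≈ w)     = refl≈ _
suffix s (sym≈ e)      = sym≈ (suffix s e)
suffix s (trans≈ e e') = trans≈ (suffix s e) (suffix s e')

rel≈ : ∀ {l r} → Rel l r → l ≈ r
rel≈ {l} {r} x = subst₂ _≈_ (++-identityʳ l) (++-identityʳ r) (step [] [] l r x)

shift : Bool → Word → Word
shift c = map (c ∷_)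

shift-⊥A : ∀ c {α β} → α ⊥A β → (c ∷ α) ⊥A (c ∷ β)
shift-⊥A c (γ , inj₁ ((d , p) , (e , q))) = c ∷ γ , inj₁ ((d , cong (c ∷_) p) , (e , cong (c ∷_) q))
shift-⊥A c (γ , inj₂ ((d , p) , (e , q))) = c ∷ γ , inj₂ ((d , cong (c ∷_) p) , (e , cong (c ∷_) q))

shift-Rel : ∀ c {l r} → Rel l r → Rel (shift c l) (shift c r)
shift-Rel c (comm α β x) = comm (c ∷ α) (c ∷ β) (shift-⊥A c x)
shift-Rel c (r11 α β)    = r11 (c ∷ α) β
shift-Rel c (r10 α β)    = r10 (c ∷ α) β
shift-Rel c (r0 α β)     = r0 (c ∷ α) β
shift-Rel c (rsq α)      = rsq (c ∷ α)

shift-≈ : ∀ c {w w'} → w ≈ w' → shift c w ≈ shift c w'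
shift-≈ c (step u v l r x) =
  subst₂ _≈_ (distrib l) (distrib r) (step (shift c u) (shift c v) _ _ (shift-Rel c x))
  where
  distrib : ∀ l → shift c u ++ shift c l ++ shift c v ≡ shift c (u ++ l ++ v)
  distrib l rewrite map-++ (c ∷_) u (l ++ v) | map-++ (c ∷_) l v = refl
shift-≈ c (refl≈ w)     = refl≈ _
shift-≈ c (sym≈ e)      = sym≈ (shift-≈ c e)
shift-≈ c (trans≈ e e') = trans≈ (shift-≈ c e) (shift-≈ c e')

data Tree : Set where
  leaf : Tree
  node : Tree → Tree → Tree

data Rot : Address → Tree → Tree → Set where
  here  : ∀ {A B C} → Rot [] (node A (node B C)) (node (node A B) C)
  left  : ∀ {α A A' B} → Rot α A A' → Rot (false ∷ α) (node A B) (node A' B)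
  right : ∀ {α A B B'} → Rot α B B' → Rot (true ∷ α) (node A B) (node A B')

data Run : Tree → Word → Tree → Set where
  nil  : ∀ {T} → Run T [] T
  cons : ∀ {α T T' w S} → Rot α T T' → Run T' w S → Run T (α ∷ w) S

_▷_ : ∀ {T u S v S'} → Run T u S → Run S v S' → Run T (u ++ v) S'
nil       ▷ y = y
cons r x  ▷ y = cons r (x ▷ y)

one : ∀ {α T T'} → Rot α T T' → Run T [ α ] T'
one r = cons r nil

runLeft : ∀ {A u S B} → Run A u S → Run (node A B) (shift false u) (node S B)
runLeft nil        = nil
runLeft (cons r x) = cons (left r) (runLeft x)

runRight : ∀ {B u S A} → Run B u S → Run (node A B) (shift true u) (node A S)
runRight nil        = nil
runRight (cons r x) = cons (right r) (runRight x)

Terminal : Tree → Set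
Terminal T = ∀ {α T'} → ¬ Rot α T T'

NormalRun : Tree → Word → Set
NormalRun T w = ∃ λ S → Run T w S × Terminal S

_▷ⁿ_ : ∀ {T u S z} → Run T u S → NormalRun S z → NormalRun T (u ++ z)
x ▷ⁿ (S' , y , t) = S' , x ▷ y , t

size : Tree → ℕ
size leaf       = 0
size (node a b) = suc (size a + size b)

μ : Tree → ℕ
μ leaf       = 0
μ (node a b) = μ a + μ b + size b

size-Rot : ∀ {α T T'} → Rot α T T' → size T' ≡ size T
size-Rot (here {A} {B} {C}) = assoc (size A) (size B) (size C)
  where
  assoc : ∀ a b c → suc (suc (a + b) + c) ≡ suc (a + suc (b + c))
  assoc = solve-∀
size-Rot (left r)  rewrite size-Rot r = refl
size-Rot (right r) rewrite size-Rot r = refl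

μ-Rot : ∀ {α T T'} → Rot α T T' → μ T' < μ T
μ-Rot (here {A} {B} {C}) =
  subst (μ' <_) (sym (expand (μ A) (μ B) (μ C) (size B) (size C))) (s≤s (m≤m+n μ' (size C)))
  where
  μ' = μ A + μ B + size B + μ C + size C
  expand : ∀ a b c sb sc → a + (b + c + sc) + suc (sb + sc) ≡ suc (a + b + sb + c + sc + sc)
  expand = solve-∀
μ-Rot (left {B = B} r) = +-monoˡ-< (size B) (+-monoˡ-< (μ B) (μ-Rot r))
μ-Rot (right {A = A} {B = B} r) rewrite size-Rot r = +-monoˡ-< (size B) (+-monoʳ-< (μ A) (μ-Rot r))

_≺_ : Tree → Tree → Set
T' ≺ T = μ T' < μ T

≺-wellFounded : WellFounded _≺_
≺-wellFounded = On.wellFounded μ <-wellFounded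

-- A tree admits no rotation exactly when it is a left comb (every right
-- child is a leaf); otherwise a rotation is found by descending leftwards.
rotationOrTerminal : ∀ T → (∃ λ α → ∃ λ T' → Rot α T T') ⊎ Terminal T
rotationOrTerminal leaf = inj₂ λ ()
rotationOrTerminal (node A (node B C)) = inj₁ ([] , _ , here)
rotationOrTerminal (node A leaf) with rotationOrTerminal A
... | inj₁ (α , A' , r) = inj₁ (false ∷ α , node A' leaf , left r)
... | inj₂ t            = inj₂ λ { (left r) → t r }

normalRun : ∀ T → ∃ (NormalRun T)
normalRun T = go T (≺-wellFounded T)
  where
  go : ∀ T → Acc _≺_ T → ∃ (NormalRun T)
  go T (acc rs) with rotationOrTerminal T
  ... | inj₂ t = [] , T , nil , t
  ... | inj₁ (α , T' , r) with go T' (rs (μ-Rot r))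
  ...   | w , n = α ∷ w , one r ▷ⁿ n

-- Local confluence.  This is where the relations R are used: each
-- overlap of two rotations at the root is closed by one relation.

record Joinable (α β : Address) (Tα Tβ : Tree) : Set where
  constructor joinable
  field
    {u v}  : Word
    {S}    : Tree
    equal  : (α ∷ u) ≈ (β ∷ v)
    runα   : Run Tα u S
    runβ   : Run Tβ v S

Joinable-sym : ∀ {α β Tα Tβ} → Joinable α β Tα Tβ → Joinable β α Tβ Tα
Joinable-sym (joinable e x y) = joinable (sym≈ e) y x

rootOverlap : ∀ {A B C β Tβ} → Rot β (node A (node B C)) Tβ →
              Joinable [] β (node (node A B) C) Tβ
rootOverlap here                      = joinable (refl≈ _) nil nil
rootOverlap (left {α = δ} r)          = joinable (sym≈ (rel≈ (r0 [] δ))) (one (left (left r))) (one here)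
rootOverlap (right here)              = joinable (rel≈ (rsq [])) (one here) (cons here (one (left here)))
rootOverlap (right (left {α = δ} r))  = joinable (sym≈ (rel≈ (r10 [] δ))) (one (left (right r))) (one here)
rootOverlap (right (right {α = δ} r)) = joinable (sym≈ (rel≈ (r11 [] δ))) (one (right r)) (one here)

disjoint : ∀ {α β A A' B B'} → Rot α A A' → Rot β B B' →
           Joinable (false ∷ α) (true ∷ β) (node A' B) (node A B')
disjoint {α} {β} r r' =
  joinable (rel≈ (comm (false ∷ α) (true ∷ β) ([] , inj₁ ((α , refl) , (β , refl)))))
           (one (right r')) (one (left r))

localConfluence : ∀ {α β T Tα Tβ} → Rot α T Tα → Rot β T Tβ → Joinable α β Tα Tβ
localConfluence here r'               = rootOverlap r'
localConfluence (left r) here         = Joinable-sym (rootOverlap (left r))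
localConfluence (right r) here        = Joinable-sym (rootOverlap (right r))
localConfluence (left r) (right r')   = disjoint r r'
localConfluence (right r) (left r')   = Joinable-sym (disjoint r' r)
localConfluence (left r) (left r') with localConfluence r r'
... | joinable e x y = joinable (shift-≈ false e) (runLeft x) (runLeft y)
localConfluence (right r) (right r') with localConfluence r r'
... | joinable e x y = joinable (shift-≈ true e) (runRight x) (runRight y)

-- Newman's argument: normal runs from a tree spell equivalent words.
-- If they start with rotations α and β, join these by u and v, continue
-- by a normal run z from the common tree and use induction below T:
--   α w ≈ α u z ≈ β v z ≈ β w'.

normalRun-unique : ∀ {T w w'} → NormalRun T w → NormalRun T w' → w ≈ w'
normalRun-unique {T} = go T (≺-wellFounded T)
  where
  go : ∀ T → Acc _≺_ T → ∀ {w w'} → NormalRun T w → NormalRun T w' → w ≈ w'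
  go T _ (_ , nil , _) (_ , nil , _)       = refl≈ _
  go T _ (_ , nil , t) (_ , cons r _ , _)  = ⊥-elim (t r)
  go T _ (_ , cons r _ , _) (_ , nil , t)  = ⊥-elim (t r)
  go T (acc rs) (S , cons {α = α} {w = w} r x , t) (S' , cons {α = β} {w = w'} r' x' , t')
    with localConfluence r r'
  ... | joinable {u} {v} e y y' with normalRun _
  ...   | z , n = begin
          α ∷ w       ≈⟨ prefix [ α ] (go _ (rs (μ-Rot r)) (S , x , t) (y ▷ⁿ n)) ⟩
          α ∷ u ++ z  ≈⟨ suffix z e ⟩
          β ∷ v ++ z  ≈⟨ prefix [ β ] (go _ (rs (μ-Rot r')) (y' ▷ⁿ n) (S' , x' , t')) ⟩
          β ∷ w'      ∎

-- Every word runs on some tree.  T ⊑ U means that U is obtained from T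
-- by grafting trees onto leaves; runs persist along ⊑.

data _⊑_ : Tree → Tree → Set where
  lf : ∀ {T} → leaf ⊑ T
  nd : ∀ {a b c d} → a ⊑ c → b ⊑ d → node a b ⊑ node c d

⊑-refl : ∀ T → T ⊑ T
⊑-refl leaf       = lf
⊑-refl (node a b) = nd (⊑-refl a) (⊑-refl b)

⊑-Rot : ∀ {α T T' U} → Rot α T T' → T ⊑ U → ∃ λ U' → Rot α U U' × T' ⊑ U'
⊑-Rot here (nd a (nd b c)) = _ , here , nd (nd a b) c
⊑-Rot (left r) (nd a b) with ⊑-Rot r a
... | _ , r' , s = _ , left r' , nd s b
⊑-Rot (right r) (nd a b) with ⊑-Rot r b
... | _ , r' , s = _ , right r' , nd a s

⊑-Run : ∀ {w T S U} → Run T w S → T ⊑ U → ∃ (Run U w)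
⊑-Run nil s = _ , nil
⊑-Run (cons r x) s with ⊑-Rot r s
... | _ , r' , s' with ⊑-Run x s'
...   | _ , x' = _ , cons r' x'

rotationInto : ∀ α T₁ → ∃ λ T → ∃ λ T' → Rot α T T' × T₁ ⊑ T'
rotationInto [] leaf                   = _ , _ , here {leaf} {leaf} {leaf} , lf
rotationInto [] (node leaf Y)          = _ , _ , here {leaf} {leaf} , nd lf (⊑-refl Y)
rotationInto [] (node (node P Q) Y)    = _ , _ , here , ⊑-refl _
rotationInto (false ∷ α) leaf with rotationInto α leaf
... | T , _ , r , _ = node T leaf , _ , left r , lf
rotationInto (false ∷ α) (node X Y) with rotationInto α X
... | T , _ , r , s = node T Y , _ , left r , nd s (⊑-refl Y)
rotationInto (true ∷ α) leaf with rotationInto α leaf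
... | T , _ , r , _ = node leaf T , _ , right r , lf
rotationInto (true ∷ α) (node X Y) with rotationInto α Y
... | T , _ , r , s = node X T , _ , right r , nd (⊑-refl X) s

-- By induction on w: place the tree on which the tail runs below the
-- result of a rotation at the head letter.
runsSomewhere : ∀ w → ∃ λ T → ∃ (Run T w)
runsSomewhere []      = leaf , leaf , nil
runsSomewhere (α ∷ w) with runsSomewhere w
... | T₁ , _ , x with rotationInto α T₁
...   | T , _ , r , s with ⊑-Run x s
...     | _ , x' = T , _ , cons r x'

upperBound : ∀ T U → ∃ λ V → T ⊑ V × U ⊑ V
upperBound leaf U                  = U , lf , ⊑-refl U
upperBound (node a b) leaf         = node a b , ⊑-refl _ , lf
upperBound (node a b) (node c d) with upperBound a c | upperBound b d
... | V , a⊑V , c⊑V | W , b⊑W , d⊑W = node V W , nd a⊑V b⊑W , nd c⊑V d⊑W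

proposition3p8 : ∀ (f g : Word) → ∃₂ λ (f' g' : Word) → (f ++ g') ≈ (g ++ f')
proposition3p8 f g with runsSomewhere f | runsSomewhere g
... | Tf , _ , xf | Tg , _ , xg with upperBound Tf Tg
...   | T , Tf⊑T , Tg⊑T with ⊑-Run xf Tf⊑T | ⊑-Run xg Tg⊑T
...     | S₁ , runf | S₂ , rung with normalRun S₁ | normalRun S₂
...       | z₁ , n₁ | z₂ , n₂ = z₂ , z₁ , normalRun-unique (runf ▷ⁿ n₁) (rung ▷ⁿ n₂)
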